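{- The category $\mathbf{Asynch}$ of asynchronous graphs has finite products and equalizers, and thus has all finite limits.
   Context: A square in a graph $G$ is a pair $(p,q)$ of paths $p,q:x\twoheadrightarrow y$ of length $2$ with the same source and target. An asynchronous graph $(G,\diamond)$ is a graph $G$ with a set $\diamond$ of squares (permutation tiles, written $p\diamond q$) such that: (1) $p\diamond q$ implies $q\diamond p$; (2) $p\diamond q$ and $p\diamond q'$ imply $q=q'$; (3) (cube property) for paths $u_1u_2u_3$ and $v_1v_2v_3$ of length 3 from $x$ to $y$, there exist edges $w_3,u_2',v_2'$ with $u_2u_3\diamond u_2'w_3$, $u_1u_2'\diamond v_1v_2'$, $v_2'w_3\diamond v_2v_3$ if and only if there exist edges $w_1,u_2'',v_2''$ with $u_1u_2\diamond w_1u_2''$, $u_2''u_3\diamond v_2''v_3$, $w_1v_2''\diamond v_1v_2$. The morphisms of $\mathbf{Asynch}$ are graph homomorphisms $f$ such that $u_1u_2\diamond v_1v_2$ implies $f(u_1)f(u_2)\diamond f(v_1)f(v_2)$. -}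

module Defs where

open import Level using (Level; suc; _⊔_)
open import Data.Product using (Σ; _×_; _,_; ∃; ∃-syntax)
open import Relation.Binary.PropositionalEquality using (_≡_)

record Graph (ℓ : Level) : Set (suc ℓ) where
  field
    Vertex : Set ℓ
    Edge   : Set ℓ
    src    : Edge → Vertex
    tgt    : Edge → Vertex

-- The set ◇ of permutation tiles is given as a relation on pairs of edges:
-- tile u₁ u₂ v₁ v₂  means  u₁u₂ ◇ v₁v₂.

record AsynchGraph (ℓ : Level) : Set (suc ℓ) where
  field
    graph : Graph ℓ
  open Graph graph public
  field
    tile : Edge → Edge → Edge → Edge → Set ℓ

    tile-square : ∀ {u₁ u₂ v₁ v₂} → tile u₁ u₂ v₁ v₂ →
      (tgt u₁ ≡ src u₂) × (tgt v₁ ≡ src v₂) ×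
      (src u₁ ≡ src v₁) × (tgt u₂ ≡ tgt v₂)

    tile-sym : ∀ {u₁ u₂ v₁ v₂} → tile u₁ u₂ v₁ v₂ → tile v₁ v₂ u₁ u₂

    tile-det : ∀ {u₁ u₂ v₁ v₂ v₁' v₂'} →
      tile u₁ u₂ v₁ v₂ → tile u₁ u₂ v₁' v₂' → (v₁ ≡ v₁') × (v₂ ≡ v₂')

    cube : ∀ (u₁ u₂ u₃ v₁ v₂ v₃ : Edge) →
      tgt u₁ ≡ src u₂ → tgt u₂ ≡ src u₃ →
      tgt v₁ ≡ src v₂ → tgt v₂ ≡ src v₃ →
      src u₁ ≡ src v₁ → tgt u₃ ≡ tgt v₃ →
      ((∃[ w₃ ] ∃[ u₂' ] ∃[ v₂' ]
          (tile u₂ u₃ u₂' w₃ × tile u₁ u₂' v₁ v₂' × tile v₂' w₃ v₂ v₃))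
        → (∃[ w₁ ] ∃[ u₂'' ] ∃[ v₂'' ]
          (tile u₁ u₂ w₁ u₂'' × tile u₂'' u₃ v₂'' v₃ × tile w₁ v₂'' v₁ v₂)))
      × ((∃[ w₁ ] ∃[ u₂'' ] ∃[ v₂'' ]
          (tile u₁ u₂ w₁ u₂'' × tile u₂'' u₃ v₂'' v₃ × tile w₁ v₂'' v₁ v₂))
        → (∃[ w₃ ] ∃[ u₂' ] ∃[ v₂' ]
          (tile u₂ u₃ u₂' w₃ × tile u₁ u₂' v₁ v₂' × tile v₂' w₃ v₂ v₃)))

open AsynchGraph

record Hom {ℓ : Level} (G H : AsynchGraph ℓ) : Set ℓ where
  field
    vmap : Vertex G → Vertex H
    emap : Edge G → Edge H
    src-hom : ∀ e → src H (emap e) ≡ vmap (src G e)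
    tgt-hom : ∀ e → tgt H (emap e) ≡ vmap (tgt G e)
    tile-hom : ∀ {u₁ u₂ v₁ v₂} → tile G u₁ u₂ v₁ v₂ →
      tile H (emap u₁) (emap u₂) (emap v₁) (emap v₂)

open Hom

-- Equality of morphisms: equality of the underlying graph homomorphisms
-- (pointwise on vertices and on edges); tile preservation is a property.
_≈_ : ∀ {ℓ} {G H : AsynchGraph ℓ} → Hom G H → Hom G H → Set ℓ
f ≈ g = (∀ x → vmap f x ≡ vmap g x) × (∀ e → emap f e ≡ emap g e)

infix 4 _≈_

open import Relation.Binary.PropositionalEquality using (trans; cong)

_∘_ : ∀ {ℓ} {A B C : AsynchGraph ℓ} → Hom B C → Hom A B → Hom A C
_∘_ {C = C} g f = record
  { vmap = λ x → vmap g (vmap f x)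
  ; emap = λ e → emap g (emap f e)
  ; src-hom = λ e → trans (src-hom g (emap f e)) (cong (vmap g) (src-hom f e))
  ; tgt-hom = λ e → trans (tgt-hom g (emap f e)) (cong (vmap g) (tgt-hom f e))
  ; tile-hom = λ t → tile-hom g (tile-hom f t)
  }

infixr 9 _∘_

IsTerminal : ∀ {ℓ} → AsynchGraph ℓ → Set (suc ℓ)
IsTerminal {ℓ} T = (A : AsynchGraph ℓ) →
  Σ (Hom A T) λ h → (h' : Hom A T) → h' ≈ h

HasTerminal : (ℓ : Level) → Set (suc ℓ)
HasTerminal ℓ = Σ (AsynchGraph ℓ) IsTerminal

IsProduct : ∀ {ℓ} (A B P : AsynchGraph ℓ) → Hom P A → Hom P B → Set (suc ℓ)
IsProduct {ℓ} A B P p q = (X : AsynchGraph ℓ) (f : Hom X A) (g : Hom X B) →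
  Σ (Hom X P) λ h → (p ∘ h ≈ f) × (q ∘ h ≈ g) ×
    ((h' : Hom X P) → p ∘ h' ≈ f → q ∘ h' ≈ g → h' ≈ h)

HasBinaryProducts : (ℓ : Level) → Set (suc ℓ)
HasBinaryProducts ℓ = (A B : AsynchGraph ℓ) →
  Σ (AsynchGraph ℓ) λ P → Σ (Hom P A) λ p → Σ (Hom P B) λ q → IsProduct A B P p q

IsEqualizer : ∀ {ℓ} {A B : AsynchGraph ℓ} (f g : Hom A B)
  (E : AsynchGraph ℓ) → Hom E A → Set (suc ℓ)
IsEqualizer {ℓ} {A} f g E e = (f ∘ e ≈ g ∘ e) ×
  ((X : AsynchGraph ℓ) (k : Hom X A) → f ∘ k ≈ g ∘ k →
    Σ (Hom X E) λ h → (e ∘ h ≈ k) × ((h' : Hom X E) → e ∘ h' ≈ k → h' ≈ h))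

HasEqualizers : (ℓ : Level) → Set (suc ℓ)
HasEqualizers ℓ = {A B : AsynchGraph ℓ} (f g : Hom A B) →
  Σ (AsynchGraph ℓ) λ E → Σ (Hom E A) λ e → IsEqualizer f g E e

-- Limits are computed as for graphs: the terminal object is a single loop whose square
-- is a tile, in the product a pair of squares is a tile when both components are, and
-- the equalizer of f, g : A → B is the subgraph of A on which f and g agree, with the
-- tiles of A. The axioms hold componentwise for the product. For the equalizer the only
-- point is that the edges produced by the cube property of A are again equalized: a tile
-- of A whose first path is equalized is sent by f and g to tiles of B with a common
-- first path, and these coincide by determinism (2).
module Submission where

open import Defs
open import Level using (Level; Lift; lift)
open import Data.Product using (Σ; _×_; _,_; proj₁; proj₂; ∃-syntax)
open import Data.Product.Properties using (Σ-≡,≡→≡)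
open import Data.Unit using (⊤; tt)
open import Relation.Binary.PropositionalEquality
  using (_≡_; refl; sym; trans; cong; cong₂; subst₂)
open import Axiom.UniquenessOfIdentityProofs.WithK using (uip)
open AsynchGraph
open Hom

module _ {ℓ : Level} where

  Tiles : Set ℓ → Set (Level.suc ℓ)
  Tiles E = E → E → E → E → Set ℓ

  CubeLeft CubeRight : {E : Set ℓ} → Tiles E → (u₁ u₂ u₃ v₁ v₂ v₃ : E) → Set ℓ
  CubeLeft ◇ u₁ u₂ u₃ v₁ v₂ v₃ = ∃[ w₃ ] ∃[ u₂' ] ∃[ v₂' ]
    (◇ u₂ u₃ u₂' w₃ × ◇ u₁ u₂' v₁ v₂' × ◇ v₂' w₃ v₂ v₃)
  CubeRight ◇ u₁ u₂ u₃ v₁ v₂ v₃ = ∃[ w₁ ] ∃[ u₂'' ] ∃[ v₂'' ]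
    (◇ u₁ u₂ w₁ u₂'' × ◇ u₂'' u₃ v₂'' v₃ × ◇ w₁ v₂'' v₁ v₂)

  CubeProperty : (G : Graph ℓ) → Tiles (Graph.Edge G) → Set ℓ
  CubeProperty G ◇ = ∀ u₁ u₂ u₃ v₁ v₂ v₃ →
    target u₁ ≡ source u₂ → target u₂ ≡ source u₃ →
    target v₁ ≡ source v₂ → target v₂ ≡ source v₃ →
    source u₁ ≡ source v₁ → target u₃ ≡ target v₃ →
    (CubeLeft ◇ u₁ u₂ u₃ v₁ v₂ v₃ → CubeRight ◇ u₁ u₂ u₃ v₁ v₂ v₃) ×
    (CubeRight ◇ u₁ u₂ u₃ v₁ v₂ v₃ → CubeLeft ◇ u₁ u₂ u₃ v₁ v₂ v₃)
    where open Graph G using () renaming (src to source; tgt to target)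

  ⊤ᴬ : AsynchGraph ℓ
  ⊤ᴬ = record
    { graph = record
      { Vertex = Lift ℓ ⊤ ; Edge = Lift ℓ ⊤ ; src = λ _ → lift tt ; tgt = λ _ → lift tt }
    ; tile = λ _ _ _ _ → Lift ℓ ⊤
    ; tile-square = λ _ → refl , refl , refl , refl
    ; tile-sym = λ _ → lift tt
    ; tile-det = λ _ _ → refl , refl
    ; cube = λ _ _ _ _ _ _ _ _ _ _ _ _ →
        (λ _ → _ , _ , _ , lift tt , lift tt , lift tt) ,
        (λ _ → _ , _ , _ , lift tt , lift tt , lift tt)
    }

  ⊤ᴬ-isTerminal : IsTerminal ⊤ᴬ
  ⊤ᴬ-isTerminal A = ! , λ _ → (λ _ → refl) , (λ _ → refl)
    where
    ! : Hom A ⊤ᴬ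
    ! = record
      { vmap = λ _ → lift tt ; emap = λ _ → lift tt
      ; src-hom = λ _ → refl ; tgt-hom = λ _ → refl ; tile-hom = λ _ → lift tt }

  module _ (A B : AsynchGraph ℓ) where

    private
      graph× : Graph ℓ
      graph× = record
        { Vertex = Vertex A × Vertex B ; Edge = Edge A × Edge B
        ; src = λ (a , b) → src A a , src B b
        ; tgt = λ (a , b) → tgt A a , tgt B b }

      open Graph graph× using () renaming (src to src×; tgt to tgt×)

      tile× : Tiles (Edge A × Edge B)
      tile× (a₁ , b₁) (a₂ , b₂) (a₃ , b₃) (a₄ , b₄) =
        tile A a₁ a₂ a₃ a₄ × tile B b₁ b₂ b₃ b₄

      square× : ∀ {u₁ u₂ v₁ v₂} → tile× u₁ u₂ v₁ v₂ →
        (tgt× u₁ ≡ src× u₂) × (tgt× v₁ ≡ src× v₂) × (src× u₁ ≡ src× v₁) × (tgt× u₂ ≡ tgt× v₂)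
      square× (tA , tB) with tile-square A tA | tile-square B tB
      ... | a₁ , a₂ , a₃ , a₄ | b₁ , b₂ , b₃ , b₄ =
        cong₂ _,_ a₁ b₁ , cong₂ _,_ a₂ b₂ , cong₂ _,_ a₃ b₃ , cong₂ _,_ a₄ b₄

      det× : ∀ {u₁ u₂ v₁ v₂ v₁' v₂'} → tile× u₁ u₂ v₁ v₂ → tile× u₁ u₂ v₁' v₂' →
        (v₁ ≡ v₁') × (v₂ ≡ v₂')
      det× (tA , tB) (tA' , tB') with tile-det A tA tA' | tile-det B tB tB'
      ... | a₁ , a₂ | b₁ , b₂ = cong₂ _,_ a₁ b₁ , cong₂ _,_ a₂ b₂

      module _ {a₁ a₂ a₃ c₁ c₂ c₃ : Edge A} {b₁ b₂ b₃ d₁ d₂ d₃ : Edge B} where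

        pairLeft : CubeLeft (tile A) a₁ a₂ a₃ c₁ c₂ c₃ → CubeLeft (tile B) b₁ b₂ b₃ d₁ d₂ d₃ →
          CubeLeft tile× (a₁ , b₁) (a₂ , b₂) (a₃ , b₃) (c₁ , d₁) (c₂ , d₂) (c₃ , d₃)
        pairLeft (w , x , y , s₁ , s₂ , s₃) (w' , x' , y' , t₁ , t₂ , t₃) =
          (w , w') , (x , x') , (y , y') , (s₁ , t₁) , (s₂ , t₂) , (s₃ , t₃)

        pairRight : CubeRight (tile A) a₁ a₂ a₃ c₁ c₂ c₃ → CubeRight (tile B) b₁ b₂ b₃ d₁ d₂ d₃ →
          CubeRight tile× (a₁ , b₁) (a₂ , b₂) (a₃ , b₃) (c₁ , d₁) (c₂ , d₂) (c₃ , d₃)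
        pairRight (w , x , y , s₁ , s₂ , s₃) (w' , x' , y' , t₁ , t₂ , t₃) =
          (w , w') , (x , x') , (y , y') , (s₁ , t₁) , (s₂ , t₂) , (s₃ , t₃)

        unpairLeft : CubeLeft tile× (a₁ , b₁) (a₂ , b₂) (a₃ , b₃) (c₁ , d₁) (c₂ , d₂) (c₃ , d₃) →
          CubeLeft (tile A) a₁ a₂ a₃ c₁ c₂ c₃ × CubeLeft (tile B) b₁ b₂ b₃ d₁ d₂ d₃
        unpairLeft ((w , w') , (x , x') , (y , y') , (s₁ , t₁) , (s₂ , t₂) , (s₃ , t₃)) =
          (w , x , y , s₁ , s₂ , s₃) , (w' , x' , y' , t₁ , t₂ , t₃)

        unpairRight : CubeRight tile× (a₁ , b₁) (a₂ , b₂) (a₃ , b₃) (c₁ , d₁) (c₂ , d₂) (c₃ , d₃) →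
          CubeRight (tile A) a₁ a₂ a₃ c₁ c₂ c₃ × CubeRight (tile B) b₁ b₂ b₃ d₁ d₂ d₃
        unpairRight ((w , w') , (x , x') , (y , y') , (s₁ , t₁) , (s₂ , t₂) , (s₃ , t₃)) =
          (w , x , y , s₁ , s₂ , s₃) , (w' , x' , y' , t₁ , t₂ , t₃)

      cube× : CubeProperty graph× tile×
      cube× (a₁ , b₁) (a₂ , b₂) (a₃ , b₃) (c₁ , d₁) (c₂ , d₂) (c₃ , d₃) e₁ e₂ e₃ e₄ e₅ e₆ =
          (λ l → let (lA , lB) = unpairLeft l in pairRight (left⇒rightᴬ lA) (left⇒rightᴮ lB))
        , (λ r → let (rA , rB) = unpairRight r in pairLeft (right⇒leftᴬ rA) (right⇒leftᴮ rB))
        where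
        open Σ (cube A a₁ a₂ a₃ c₁ c₂ c₃ (cong proj₁ e₁) (cong proj₁ e₂) (cong proj₁ e₃)
                  (cong proj₁ e₄) (cong proj₁ e₅) (cong proj₁ e₆))
          renaming (proj₁ to left⇒rightᴬ; proj₂ to right⇒leftᴬ)
        open Σ (cube B b₁ b₂ b₃ d₁ d₂ d₃ (cong proj₂ e₁) (cong proj₂ e₂) (cong proj₂ e₃)
                  (cong proj₂ e₄) (cong proj₂ e₅) (cong proj₂ e₆))
          renaming (proj₁ to left⇒rightᴮ; proj₂ to right⇒leftᴮ)

    _×ᴬ_ : AsynchGraph ℓ
    _×ᴬ_ = record
      { graph = graph×
      ; tile = tile×
      ; tile-square = square×
      ; tile-sym = λ (tA , tB) → tile-sym A tA , tile-sym B tB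
      ; tile-det = det×
      ; cube = cube×
      }

    π₁ : Hom _×ᴬ_ A
    π₁ = record
      { vmap = proj₁ ; emap = proj₁ ; src-hom = λ _ → refl ; tgt-hom = λ _ → refl
      ; tile-hom = proj₁ }

    π₂ : Hom _×ᴬ_ B
    π₂ = record
      { vmap = proj₂ ; emap = proj₂ ; src-hom = λ _ → refl ; tgt-hom = λ _ → refl
      ; tile-hom = proj₂ }

    ⟨_,_⟩ : {X : AsynchGraph ℓ} → Hom X A → Hom X B → Hom X _×ᴬ_
    ⟨ f , g ⟩ = record
      { vmap = λ x → vmap f x , vmap g x
      ; emap = λ e → emap f e , emap g e
      ; src-hom = λ e → cong₂ _,_ (src-hom f e) (src-hom g e)
      ; tgt-hom = λ e → cong₂ _,_ (tgt-hom f e) (tgt-hom g e)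
      ; tile-hom = λ t → tile-hom f t , tile-hom g t }

    ×ᴬ-isProduct : IsProduct A B _×ᴬ_ π₁ π₂
    ×ᴬ-isProduct X f g =
      ⟨ f , g ⟩ , ((λ _ → refl) , (λ _ → refl)) , ((λ _ → refl) , (λ _ → refl)) ,
      λ h π₁∘h≈f π₂∘h≈g →
        (λ x → cong₂ _,_ (proj₁ π₁∘h≈f x) (proj₁ π₂∘h≈g x)) ,
        (λ e → cong₂ _,_ (proj₂ π₁∘h≈f e) (proj₂ π₂∘h≈g e))

  proj₁-injective : {X Y : Set ℓ} {f g : X → Y} {x y : Σ X λ a → f a ≡ g a} →
    proj₁ x ≡ proj₁ y → x ≡ y
  proj₁-injective p = Σ-≡,≡→≡ (p , uip _ _)

  module _ {A B : AsynchGraph ℓ} (f g : Hom A B) where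

    Equalized : Edge A → Set ℓ
    Equalized e = emap f e ≡ emap g e

    src-equalized : ∀ {e} → Equalized e → vmap f (src A e) ≡ vmap g (src A e)
    src-equalized {e} fe≡ge = trans (sym (src-hom f e)) (trans (cong (src B) fe≡ge) (src-hom g e))

    tgt-equalized : ∀ {e} → Equalized e → vmap f (tgt A e) ≡ vmap g (tgt A e)
    tgt-equalized {e} fe≡ge = trans (sym (tgt-hom f e)) (trans (cong (tgt B) fe≡ge) (tgt-hom g e))

    tile-equalized : ∀ {u₁ u₂ v₁ v₂} → tile A u₁ u₂ v₁ v₂ →
      Equalized u₁ → Equalized u₂ → Equalized v₁ × Equalized v₂
    tile-equalized t fu₁≡gu₁ fu₂≡gu₂ =
      tile-det B (tile-hom f t)
        (subst₂ (λ x y → tile B x y _ _) (sym fu₁≡gu₁) (sym fu₂≡gu₂) (tile-hom g t))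

    private
      graphᴱ : Graph ℓ
      graphᴱ = record
        { Vertex = Σ (Vertex A) λ x → vmap f x ≡ vmap g x
        ; Edge = Σ (Edge A) Equalized
        ; src = λ (e , fe≡ge) → src A e , src-equalized fe≡ge
        ; tgt = λ (e , fe≡ge) → tgt A e , tgt-equalized fe≡ge }

      tileᴱ : Tiles (Σ (Edge A) Equalized)
      tileᴱ u₁ u₂ v₁ v₂ = tile A (proj₁ u₁) (proj₁ u₂) (proj₁ v₁) (proj₁ v₂)

      cubeᴱ : CubeProperty graphᴱ tileᴱ
      cubeᴱ u₁ u₂ u₃ v₁ v₂ v₃ e₁ e₂ e₃ e₄ e₅ e₆ =
          (λ l → restrictRight (left⇒rightᴬ (forgetLeft l)))
        , (λ r → restrictLeft (right⇒leftᴬ (forgetRight r)))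
        where
        open Σ (cube A (proj₁ u₁) (proj₁ u₂) (proj₁ u₃) (proj₁ v₁) (proj₁ v₂) (proj₁ v₃)
                  (cong proj₁ e₁) (cong proj₁ e₂) (cong proj₁ e₃)
                  (cong proj₁ e₄) (cong proj₁ e₅) (cong proj₁ e₆))
          renaming (proj₁ to left⇒rightᴬ; proj₂ to right⇒leftᴬ)

        forgetLeft : CubeLeft tileᴱ u₁ u₂ u₃ v₁ v₂ v₃ →
          CubeLeft (tile A) (proj₁ u₁) (proj₁ u₂) (proj₁ u₃) (proj₁ v₁) (proj₁ v₂) (proj₁ v₃)
        forgetLeft ((w , _) , (x , _) , (y , _) , ts) = w , x , y , ts

        forgetRight : CubeRight tileᴱ u₁ u₂ u₃ v₁ v₂ v₃ →
          CubeRight (tile A) (proj₁ u₁) (proj₁ u₂) (proj₁ u₃) (proj₁ v₁) (proj₁ v₂) (proj₁ v₃)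
        forgetRight ((w , _) , (x , _) , (y , _) , ts) = w , x , y , ts

        restrictLeft :
          CubeLeft (tile A) (proj₁ u₁) (proj₁ u₂) (proj₁ u₃) (proj₁ v₁) (proj₁ v₂) (proj₁ v₃) →
          CubeLeft tileᴱ u₁ u₂ u₃ v₁ v₂ v₃
        restrictLeft (w₃ , u₂' , v₂' , t₁ , t₂ , t₃) =
          let (fu₂'≡gu₂' , fw₃≡gw₃) = tile-equalized t₁ (proj₂ u₂) (proj₂ u₃)
              (_ , fv₂'≡gv₂') = tile-equalized t₂ (proj₂ u₁) fu₂'≡gu₂'
          in (w₃ , fw₃≡gw₃) , (u₂' , fu₂'≡gu₂') , (v₂' , fv₂'≡gv₂') , t₁ , t₂ , t₃

        restrictRight :
          CubeRight (tile A) (proj₁ u₁) (proj₁ u₂) (proj₁ u₃) (proj₁ v₁) (proj₁ v₂) (proj₁ v₃) →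
          CubeRight tileᴱ u₁ u₂ u₃ v₁ v₂ v₃
        restrictRight (w₁ , u₂'' , v₂'' , t₁ , t₂ , t₃) =
          let (fw₁≡gw₁ , fu₂''≡gu₂'') = tile-equalized t₁ (proj₂ u₁) (proj₂ u₂)
              (fv₂''≡gv₂'' , _) = tile-equalized t₂ fu₂''≡gu₂'' (proj₂ u₃)
          in (w₁ , fw₁≡gw₁) , (u₂'' , fu₂''≡gu₂'') , (v₂'' , fv₂''≡gv₂'') , t₁ , t₂ , t₃

    Eqᴬ : AsynchGraph ℓ
    Eqᴬ = record
      { graph = graphᴱ
      ; tile = tileᴱ
      ; tile-square = λ t → let (e₁ , e₂ , e₃ , e₄) = tile-square A t in
          proj₁-injective e₁ , proj₁-injective e₂ , proj₁-injective e₃ , proj₁-injective e₄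
      ; tile-sym = tile-sym A
      ; tile-det = λ t t' → let (e₁ , e₂) = tile-det A t t' in
          proj₁-injective e₁ , proj₁-injective e₂
      ; cube = cubeᴱ
      }

    ι : Hom Eqᴬ A
    ι = record
      { vmap = proj₁ ; emap = proj₁ ; src-hom = λ _ → refl ; tgt-hom = λ _ → refl
      ; tile-hom = λ t → t }

    Eqᴬ-isEqualizer : IsEqualizer f g Eqᴬ ι
    Eqᴬ-isEqualizer = (proj₂ , proj₂) , λ X k f∘k≈g∘k →
      record
        { vmap = λ x → vmap k x , proj₁ f∘k≈g∘k x
        ; emap = λ e → emap k e , proj₂ f∘k≈g∘k e
        ; src-hom = λ e → proj₁-injective (src-hom k e)
        ; tgt-hom = λ e → proj₁-injective (tgt-hom k e)
        ; tile-hom = tile-hom k }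
      , ((λ _ → refl) , (λ _ → refl))
      , λ h ι∘h≈k → (λ x → proj₁-injective (proj₁ ι∘h≈k x)) , (λ e → proj₁-injective (proj₂ ι∘h≈k e))

mainTheorem5 : (ℓ : Level) →
    HasTerminal ℓ × HasBinaryProducts ℓ × HasEqualizers ℓ
mainTheorem5 ℓ =
    (⊤ᴬ , ⊤ᴬ-isTerminal)
  , (λ A B → A ×ᴬ B , π₁ A B , π₂ A B , ×ᴬ-isProduct A B)
  , (λ f g → Eqᴬ f g , ι f g , Eqᴬ-isEqualizer f g)
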